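{- Let $\mathcal{L}_1$ and $\mathcal{L}_2$ be LTSs. For all states $(U,s),(V,s)$ of $\mathsf{norm}_{\mathsf{fdr}}(\mathcal{L}_1)\ltimes\mathcal{L}_2$ with $(U,s)\leq(V,s)$ and every sequence $\sigma\in\mathit{Act}_\tau^*$: if $(V,s)\overset{\sigma}{\twoheadrightarrow}x$ for some FD-witness $x$, then $(U,s)\overset{\sigma}{\twoheadrightarrow}y$ for some FD-witness $y$.
   Context: Fix a finite set $\mathit{Act}$ of actions not containing the internal action $\tau$; $\mathit{Act}_\tau=\mathit{Act}\cup\{\tau\}$. An LTS is $(S,\iota,\rightarrow)$ with $\iota\in S$ and $\rightarrow\subseteq S\times\mathit{Act}_\tau\times S$; $\mathsf{enabled}(s)=\{a\in\mathit{Act}_\tau\mid\exists t: s\xrightarrow{a}t\}$. For $\sigma\in\mathit{Act}_\tau^*$, $s\overset{\sigma}{\twoheadrightarrow}t$ means there is a path from $s$ to $t$ whose labels, in order, form exactly $\sigma$. The weak transition $s\overset{a}{\Longrightarrow}t$ ($a\in\mathit{Act}$) holds iff there is a path from $s$ to $t$ consisting of $\tau$-transitions, one $a$-transition, and $\tau$-transitions; $s\overset{\epsilon}{\Longrightarrow}t$ iff $t$ is reachable from $s$ by $\tau$-transitions only. A state $s$ is stable if $\tau\notin\mathsf{enabled}(s)$; for stable $s$, $\mathsf{refusals}(s)=\mathcal{P}(\mathit{Act}\setminus\mathsf{enabled}(s))$; for a set $U$, $\mathsf{refusals}(U)=\{X\subseteq\mathit{Act}\mid\exists s\in U: s\text{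 stable}\wedge X\in\mathsf{refusals}(s)\}$. A state diverges if there is an infinite sequence of $\tau$-transitions from it; a set diverges if one of its states does. For $\mathcal{L}_1=(S_1,\iota_1,\rightarrow_1)$, $\mathsf{norm}_{\mathsf{fdr}}(\mathcal{L}_1)$ has states $\mathcal{P}(S_1)$, initial state $\{s\mid\iota_1\overset{\epsilon}{\Longrightarrow}s\}$, and for $U,V\subseteq S_1$, $a\in\mathit{Act}$: $U\xrightarrow{a}V$ iff $U$ does not diverge and $V=\{t\mid\exists s\in U: s\overset{a}{\Longrightarrow}t\}$. For $\mathcal{L}_2=(S_2,\iota_2,\rightarrow_2)$, the product $\mathcal{M}\ltimes\mathcal{L}_2$ of $\mathcal{M}=(T,\iota_T,\rightarrow_T)$ and $\mathcal{L}_2$ has states $T\times S_2$, initial state $(\iota_T,\iota_2)$, and the smallest transition relation with $(u,s)\xrightarrow{\tau}(u,t)$ if $s\xrightarrow{\tau}_2t$, and $(u,s)\xrightarrow{a}(u',t)$ if $u\xrightarrow{a}_Tu'$ and $s\xrightarrow{a}_2t$ for $a\in\mathit{Act}$. States of $\mathsf{norm}_{\mathsf{fdr}}(\mathcal{L}_1)\ltimes\mathcal{L}_2$ are ordered by $(U,s)\leq(V,t)$ iff $s=t$ and $U\subseteq V$. A state $(U,s)$ of this product is an FD-witness iff $U$ does not diverge and at least one holds: $U=\emptyset$; or $s$ is stable and $\mathsf{refusals}(s)\not\subseteq\mathsf{refusals}(U)$; or $s$ diverges. -}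

module Defs where

open import Level using (Level; _⊔_; suc; zero)
open import Data.Nat using (ℕ) renaming (suc to sucℕ)
open import Data.Fin using (Fin)
open import Data.Fin.Subset using (_∈_) renaming (Subset to FSubset)
open import Data.List using (List; []; _∷_)
open import Data.Product using (Σ; ∃; _×_; _,_)
open import Data.Sum using (_⊎_)
open import Data.Empty using (⊥)
open import Relation.Nullary using (¬_)
open import Relation.Binary.PropositionalEquality using (_≡_)
open import Relation.Binary.Construct.Closure.ReflexiveTransitive using (Star)

data Actτ (n : ℕ) : Set where
  τ   : Actτ n
  act : Fin n → Actτ n

record LTS (n : ℕ) (ℓ : Level) : Set (suc ℓ) where
  field
    State : Set ℓ
    init  : State
    _⟶⟨_⟩_ : State → Actτ n → State → Set ℓ

module _ {n : ℕ} {ℓ : Level} (L : LTS n ℓ) where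
  open LTS L

  enabled : State → Actτ n → Set ℓ
  enabled s a = ∃ λ t → s ⟶⟨ a ⟩ t

  stable : State → Set ℓ
  stable s = ¬ enabled s τ

  data Path : State → List (Actτ n) → State → Set ℓ where
    [] : ∀ {s} → Path s [] s
    _∷_ : ∀ {s a t σ u} → s ⟶⟨ a ⟩ t → Path t σ u → Path s (a ∷ σ) u

  τ-step : State → State → Set ℓ
  τ-step s t = s ⟶⟨ τ ⟩ t

  εweak : State → State → Set ℓ
  εweak = Star τ-step

  weak : State → Fin n → State → Set ℓ
  weak s a t = ∃ λ s' → ∃ λ t' → εweak s s' × s' ⟶⟨ act a ⟩ t' × εweak t' t

  diverges : State → Set ℓ
  diverges s = ∃ λ (f : ℕ → State) → f 0 ≡ s × (∀ i → f i ⟶⟨ τ ⟩ f (sucℕ i))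

  Subset : Set (suc ℓ)
  Subset = State → Set ℓ

  ActSet : Set
  ActSet = FSubset n

  -- X ∈ refusals(s) for stable s: X ⊆ Act ∖ enabled(s)
  refuses : State → ActSet → Set ℓ
  refuses s X = ∀ a → a ∈ X → ¬ enabled s (act a)

  refusalsOf : Subset → ActSet → Set ℓ
  refusalsOf U X = ∃ λ s → U s × stable s × refuses s X

  divergesSet : Subset → Set ℓ
  divergesSet U = ∃ λ s → U s × diverges s

  emptySet : Subset → Set ℓ
  emptySet U = ∀ s → ¬ U s

  _⊆_ : Subset → Subset → Set ℓ
  U ⊆ V = ∀ s → U s → V s

  -- U --a--> V in norm_fdr(L): U does not diverge and V = {t | ∃ s ∈ U. s =a=> t}
  -- (set equality expressed extensionally)
  normStep : Subset → Fin n → Subset → Set ℓ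
  normStep U a V = ¬ divergesSet U × (∀ t → (V t → ∃ λ s → U s × weak s a t) × ((∃ λ s → U s × weak s a t) → V t))

  normInit : Subset
  normInit s = εweak init s

module Product {n : ℕ} {ℓ : Level} (L₁ L₂ : LTS n ℓ) where
  private
    module L₁ = LTS L₁
    module L₂ = LTS L₂

  PState : Set (suc ℓ)
  PState = Subset L₁ × L₂.State

  data _⟹⟨_⟩_ : PState → Actτ n → PState → Set (suc ℓ) where
    τ-move : ∀ {U s t} → s L₂.⟶⟨ τ ⟩ t → (U , s) ⟹⟨ τ ⟩ (U , t)
    a-move : ∀ {U U' s t a} → normStep L₁ U a U' → s L₂.⟶⟨ act a ⟩ t →
             (U , s) ⟹⟨ act a ⟩ (U' , t)

  product : LTS n (suc ℓ)
  product = record { State = PState ; init = (normInit L₁ , L₂.init) ; _⟶⟨_⟩_ = _⟹⟨_⟩_ }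

  _≤P_ : PState → PState → Set ℓ
  (U , s) ≤P (V , t) = (s ≡ t) × _⊆_ L₁ U V

  refusals⊆ : L₂.State → Subset L₁ → Set ℓ
  refusals⊆ s U = ∀ (X : ActSet L₂) → refuses L₂ s X → refusalsOf L₁ U X

  FDWitness : PState → Set ℓ
  FDWitness (U , s) =
    ¬ divergesSet L₁ U ×
    (emptySet L₁ U ⊎ (stable L₂ s × ¬ refusals⊆ s U) ⊎ diverges L₂ s)

module Submission where

-- Shrinking the first component of a state (U , s) of
-- norm_fdr(L₁) ⋉ L₂ can only help it: every path from (V , s) is mirrored,
-- label for label, by a path from any smaller (U , s), ending in a state
-- that is again smaller than the original end state; and being an
-- FD-witness is downward closed in the first component.

open import Defs
open import Level using (Level)
open import Data.Nat using (ℕ)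
open import Data.Fin using (Fin)
open import Data.List using (List)
open import Data.Product using (∃; _×_; _,_; proj₂)
open import Data.Sum using (_⊎_; inj₁; inj₂)
open import Relation.Nullary using (¬_)

module SubsetOrder {n : ℕ} {ℓ : Level} (L : LTS n ℓ) where

  after : Subset L → Fin n → Subset L
  after U a t = ∃ λ s → U s × weak L s a t

  after-mono : ∀ {U V} a → _⊆_ L U V → _⊆_ L (after U a) (after V a)
  after-mono a U⊆V t (s , s∈U , s⇒t) = s , U⊆V s s∈U , s⇒t

  nondivergence-antitone : ∀ {U V} → _⊆_ L U V → ¬ divergesSet L V → ¬ divergesSet L U
  nondivergence-antitone U⊆V V↛ (s , s∈U , s↑) = V↛ (s , U⊆V s s∈U , s↑)

  emptiness-antitone : ∀ {U V} → _⊆_ L U V → emptySet L V → emptySet L U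
  emptiness-antitone U⊆V V=∅ s s∈U = V=∅ s (U⊆V s s∈U)

  refusals-mono : ∀ {U V} X → _⊆_ L U V → refusalsOf L U X → refusalsOf L V X
  refusals-mono X U⊆V (s , s∈U , s-stable , s-refuses) = s , U⊆V s s∈U , s-stable , s-refuses

  normStep-after : ∀ {U} a → ¬ divergesSet L U → normStep L U a (after U a)
  normStep-after a U↛ = U↛ , λ t → (λ t∈ → t∈) , (λ t∈ → t∈)

  after-⊆-normStep : ∀ {V V'} a → normStep L V a V' → _⊆_ L (after V a) V'
  after-⊆-normStep a (_ , V'≡after) t = proj₂ (V'≡after t)

module ProductOrder {n : ℕ} {ℓ : Level} (L₁ L₂ : LTS n ℓ) where
  open Product L₁ L₂
  open SubsetOrder L₁

  refusals⊆-mono : ∀ {U V} s → _⊆_ L₁ U V → refusals⊆ s U → refusals⊆ s V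
  refusals⊆-mono s U⊆V s⊑U X s-refuses = refusals-mono X U⊆V (s⊑U X s-refuses)

  FDWitness-antitone : ∀ {U V} t → _⊆_ L₁ U V → FDWitness (V , t) → FDWitness (U , t)
  FDWitness-antitone {U} {V} t U⊆V (V↛ , reason) = nondivergence-antitone U⊆V V↛ , shrink reason
    where
    shrink : emptySet L₁ V ⊎ (stable L₂ t × ¬ refusals⊆ t V) ⊎ diverges L₂ t →
             emptySet L₁ U ⊎ (stable L₂ t × ¬ refusals⊆ t U) ⊎ diverges L₂ t
    shrink (inj₁ V=∅)                     = inj₁ (emptiness-antitone U⊆V V=∅)
    shrink (inj₂ (inj₁ (t-stable , t⋢V))) = inj₂ (inj₁ (t-stable , λ t⊑U → t⋢V (refusals⊆-mono t U⊆V t⊑U)))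
    shrink (inj₂ (inj₂ t↑))               = inj₂ (inj₂ t↑)

  step-simulation : ∀ {U V V' s t a} → _⊆_ L₁ U V → (V , s) ⟹⟨ a ⟩ (V' , t) →
                    ∃ λ U' → (U , s) ⟹⟨ a ⟩ (U' , t) × _⊆_ L₁ U' V'
  step-simulation {U} U⊆V (τ-move s→t) = U , τ-move s→t , U⊆V
  step-simulation {U} U⊆V (a-move {a = a} V⟶V'@(V↛ , _) s→t) =
    after U a ,
    a-move (normStep-after a (nondivergence-antitone U⊆V V↛)) s→t ,
    λ r r∈ → after-⊆-normStep a V⟶V' r (after-mono a U⊆V r r∈)

  path-simulation : ∀ {U V V' s t} {σ : List (Actτ n)} → _⊆_ L₁ U V →
                    Path product (V , s) σ (V' , t) →
                    ∃ λ U' → Path product (U , s) σ (U' , t) × _⊆_ L₁ U' V'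
  path-simulation U⊆V []            = _ , [] , U⊆V
  path-simulation U⊆V (step ∷ path)
    with step-simulation U⊆V step
  ... | W , step' , W⊆ with path-simulation W⊆ path
  ...   | U' , path' , U'⊆V' = U' , step' ∷ path' , U'⊆V'

corollary5p10 : {n : ℕ} {ℓ : Level} (L₁ L₂ : LTS n ℓ) → let open Product L₁ L₂ in (U V : Subset L₁) (s : LTS.State L₂) → (U , s) ≤P (V , s) → (σ : List (Actτ n)) → (∃ λ x → Path product (V , s) σ x × FDWitness x) → ∃ λ y → Path product (U , s) σ y × FDWitness y
corollary5p10 L₁ L₂ U V s (_ , U⊆V) σ ((V' , t) , path , witness)
  with ProductOrder.path-simulation L₁ L₂ U⊆V path
... | U' , path' , U'⊆V' = (U' , t) , path' , ProductOrder.FDWitness-antitone L₁ L₂ t U'⊆V' witness
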